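{- Let $L$ be an orbit of the reverted action of $B_\infty\times B_\infty$ on $S_{2\infty}\times S_{2\infty}$, let $(x,y)\in L$, and define $m_L=m_L(x,y)$ by $2m_L=|S(xy)|+|t(S(xy))|+|DS(x)|+|DS(y)|$. Then $|CS(x',y')|\le 2m_L$ for all $(x',y')\in L$, and $m_L(x',y')=m_L(x,y)$ for all $(x',y')\in L$.
   Context: $S_{2\infty}$ is the group of finitely supported permutations of the positive integers; $B_n\subseteq S_{2n}$ is the centralizer of $(1\,2)(3\,4)\cdots(2n-1\,2n)$ and $B_\infty=\bigcup_nB_n$. The reverted action is $(a,b)\cdot_r(x,y)=(axb^{ -1},bya^{ -1})$ for $a,b\in B_\infty$. The partner map $t$ is $t(2i-1)=2i$, $t(2i)=2i-1$; couples $D_i=\{2i-1,2i\}$, $\mathbb{D}=\{D_i\}$. $S(x)=\{i:x(i)\ne i\}$, $D(x)=\{D_i\in\mathbb{D}:x(D_i)\notin\mathbb{D}\}$, $DS(x)=\bigcup_{D_i\in D(x)}D_i$, $DS(x,y)=DS(x)\cup DS(y)$, and $CS(x,y)=S(xy)\cup t(S(xy))\cup DS(x,y)$. -}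

module Defs where

open import Data.Nat using (ℕ; zero; suc; _+_; _≤_; _≡ᵇ_)
open import Data.Bool using (Bool; true; false; not; _∨_; if_then_else_)
open import Data.Product using (Σ; ∃; _×_)
open import Relation.Binary.PropositionalEquality using (_≡_)

-- Convention: the positive integer k+1 is represented by k : ℕ.
-- Couples D_i = {2i-1, 2i} become {2i-2, 2i-1}, i.e. {0,1}, {2,3}, ...

t : ℕ → ℕ
t zero = 1
t (suc zero) = 0
t (suc (suc k)) = suc (suc (t k))

record FinPerm : Set where
  field
    fun     : ℕ → ℕ
    inv     : ℕ → ℕ
    fun-inv : ∀ i → fun (inv i) ≡ i
    inv-fun : ∀ i → inv (fun i) ≡ i
    bound   : ℕ
    fixed   : ∀ i → bound ≤ i → fun i ≡ i
open FinPerm public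

-- B_∞ : finitely supported permutations commuting with t
-- (the centralizer of (1 2)(3 4)... ; a finitely supported one lies in some B_n)
InB : FinPerm → Set
InB a = ∀ i → fun a (t i) ≡ t (fun a i)

-- (x', y') lies in the orbit of (x, y) under the reverted action
-- (a,b)·(x,y) = (a x b⁻¹, b y a⁻¹), products = composition of functions
InOrbit : FinPerm → FinPerm → FinPerm → FinPerm → Set
InOrbit x y x' y' =
  Σ FinPerm λ a → Σ FinPerm λ b → InB a × InB b ×
    ((∀ i → fun x' i ≡ fun a (fun x (inv b i))) ×
     (∀ i → fun y' i ≡ fun b (fun y (inv a i))))

count : (ℕ → Bool) → ℕ → ℕ
count P zero = 0
count P (suc n) = (if P n then 1 else 0) + count P n

inS : (ℕ → ℕ) → ℕ → Bool
inS f k = not (f k ≡ᵇ k)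

prod : FinPerm → FinPerm → ℕ → ℕ
prod x y k = fun x (fun y k)

inSxy : FinPerm → FinPerm → ℕ → Bool
inSxy x y = inS (prod x y)

-- k ∈ t(S(xy))  iff  t k ∈ S(xy)   (t is an involution)
inTSxy : FinPerm → FinPerm → ℕ → Bool
inTSxy x y k = inSxy x y (t k)

-- k ∈ DS(x) iff the couple of k is mapped by x to a non-couple,
-- i.e. x(t k) is not the partner of x(k)
inDS : FinPerm → ℕ → Bool
inDS x k = not (fun x (t k) ≡ᵇ t (fun x k))

inCS : FinPerm → FinPerm → ℕ → Bool
inCS x y k = inSxy x y k ∨ inTSxy x y k ∨ inDS x k ∨ inDS y k

-- a bound beyond which none of the above sets has elements
-- (all of them are contained in {0, ..., bound x + bound y + 1})
cbound : FinPerm → FinPerm → ℕ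
cbound x y = bound x + bound y + 2

card : FinPerm → FinPerm → (ℕ → Bool) → ℕ
card x y P = count P (cbound x y)

twoM : FinPerm → FinPerm → ℕ
twoM x y = card x y (inSxy x y) + card x y (inTSxy x y)
         + card x y (inDS x) + card x y (inDS y)

cardCS : FinPerm → FinPerm → ℕ
cardCS x y = card x y (inCS x y)

module Submission where

-- Let (x', y') = (a x b⁻¹, b y a⁻¹) with a, b ∈ B_∞.  Then
--   * x'y' = a (xy) a⁻¹, so S(x'y') = a(S(xy)), and since a commutes with the
--     partner map t, also t(S(x'y')) = a(t(S(xy)));
--   * x' sends the couple of k to a couple iff x sends the couple of b⁻¹k to a
--     couple, so DS(x') = b(DS(x)); symmetrically DS(y') = a(DS(y)).
-- Each of the four sets summed in 2m_L is thus the image of the corresponding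
-- set for (x, y) under a bijection, and counting is invariant under bijections;
-- this gives m_L(x', y') = m_L(x, y).  The bound |CS(x', y')| ≤ 2m_L is then
-- the union bound |A ∪ B| ≤ |A| + |B| applied to CS(x', y').

open import Defs
open import Data.Nat using (ℕ; _≤_)
open import Data.Product using (_×_)
open import Relation.Binary.PropositionalEquality using (_≡_)

open import Data.Nat using (zero; suc; _+_; _<_; _≡ᵇ_; z≤n; s≤s; _<?_)
open import Data.Nat.Properties
open import Data.Bool using (Bool; true; false; not; _∨_; if_then_else_)
open import Data.Bool.Properties using (T-≡)
open import Data.Product using (_,_; proj₁; proj₂)
open import Data.Empty using (⊥-elim)
open import Data.Sum using (inj₁; inj₂)
open import Function.Bundles using (Equivalence)
open import Relation.Nullary using (yes; no)
open import Relation.Binary.PropositionalEquality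
  using (refl; sym; trans; cong; cong₂; subst; _≢_)

≡ᵇ-refl : ∀ n → (n ≡ᵇ n) ≡ true
≡ᵇ-refl n = Equivalence.to T-≡ (≡⇒≡ᵇ n n refl)

≡ᵇ-false : ∀ {m n} → m ≢ n → (m ≡ᵇ n) ≡ false
≡ᵇ-false {m} {n} m≢n with m ≡ᵇ n in eq
... | false = refl
... | true  = ⊥-elim (m≢n (≡ᵇ⇒≡ m n (Equivalence.from T-≡ eq)))

≡ᵇ-injective : (f : ℕ → ℕ) → (∀ {i j} → f i ≡ f j → i ≡ j) →
  ∀ m n → (f m ≡ᵇ f n) ≡ (m ≡ᵇ n)
≡ᵇ-injective f f-inj m n with m ≟ n
... | yes refl = trans (≡ᵇ-refl (f m)) (sym (≡ᵇ-refl m))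
... | no m≢n   = trans (≡ᵇ-false (λ e → m≢n (f-inj e))) (sym (≡ᵇ-false m≢n))

Below : (ℕ → Bool) → ℕ → Set
Below P N = ∀ k → P k ≡ true → k < N

count-ext : ∀ n (P Q : ℕ → Bool) → (∀ i → i < n → P i ≡ Q i) →
  count P n ≡ count Q n
count-ext zero    P Q P≗Q = refl
count-ext (suc n) P Q P≗Q rewrite P≗Q n ≤-refl =
  cong ((if Q n then 1 else 0) +_)
       (count-ext n P Q (λ i i<n → P≗Q i (m<n⇒m<1+n i<n)))

remove : (ℕ → Bool) → ℕ → ℕ → Bool
remove P j i = if i ≡ᵇ j then false else P i

count-remove : ∀ N P j → j < N → P j ≡ true →
  suc (count (remove P j) N) ≡ count P N
count-remove (suc n) P j j<1+n Pj with j ≟ n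
... | yes refl rewrite ≡ᵇ-refl j | Pj =
  cong suc (count-ext n (remove P j) P
    (λ i i<n → cong (λ b → if b then false else P i) (≡ᵇ-false (<⇒≢ i<n))))
... | no j≢n with m<1+n⇒m<n∨m≡n j<1+n
...   | inj₂ j≡n = ⊥-elim (j≢n j≡n)
...   | inj₁ j<n rewrite ≡ᵇ-false {n} {j} (λ e → j≢n (sym e))
                   with P n | count-remove n P j j<n Pj
...     | true  | ih = cong suc ih
...     | false | ih = ih

count-injection-≤ : ∀ M (f : ℕ → ℕ) → (∀ {i j} → f i ≡ f j → i ≡ j) →
  (Q : ℕ → Bool) → ∀ N (P : ℕ → Bool) →
  (∀ k → k < M → Q k ≡ true → (f k < N) × (P (f k) ≡ true)) →
  count Q M ≤ count P N
count-injection-≤ zero    f f-inj Q N P maps = z≤n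
count-injection-≤ (suc m) f f-inj Q N P maps with Q m in Qm
... | false = count-injection-≤ m f f-inj Q N P (λ k k<m → maps k (m<n⇒m<1+n k<m))
... | true  =
  subst (suc (count Q m) ≤_) (count-remove N P (f m) fm<N Pfm)
    (s≤s (count-injection-≤ m f f-inj Q N (remove P (f m)) maps-remove))
  where
  fm<N = proj₁ (maps m ≤-refl Qm)
  Pfm  = proj₂ (maps m ≤-refl Qm)
  -- f m is hit only by m, so the other elements of Q land in P minus f m.
  maps-remove : ∀ k → k < m → Q k ≡ true →
    (f k < N) × (remove P (f m) (f k) ≡ true)
  maps-remove k k<m Qk rewrite ≡ᵇ-false {f k} {f m} (λ e → <⇒≢ k<m (f-inj e)) =
    maps k (m<n⇒m<1+n k<m) Qk

count-bijection : (σ σ⁻¹ : ℕ → ℕ) → (∀ i → σ (σ⁻¹ i) ≡ i) → (∀ i → σ⁻¹ (σ i) ≡ i) →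
  (P Q : ℕ → Bool) → (∀ k → Q k ≡ P (σ k)) → ∀ N M →
  Below P N → Below Q M → count Q M ≡ count P N
count-bijection σ σ⁻¹ σσ⁻¹ σ⁻¹σ P Q Q≡Pσ N M P<N Q<M = ≤-antisym
  (count-injection-≤ M σ (injective σ⁻¹ σ σ⁻¹σ) Q N P
     (λ k _ Qk → let Pσk = trans (sym (Q≡Pσ k)) Qk in P<N (σ k) Pσk , Pσk))
  (count-injection-≤ N σ⁻¹ (injective σ σ⁻¹ σσ⁻¹) P M Q
     (λ k _ Pk → let Qσ⁻¹k = trans (Q≡Pσ (σ⁻¹ k)) (trans (cong P (σσ⁻¹ k)) Pk)
                 in Q<M (σ⁻¹ k) Qσ⁻¹k , Qσ⁻¹k))
  where
  injective : (g f : ℕ → ℕ) → (∀ i → g (f i) ≡ i) → ∀ {i j} → f i ≡ f j → i ≡ j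
  injective g f gf {i} {j} e = trans (sym (gf i)) (trans (cong g e) (gf j))

count-∨ : ∀ n (A B : ℕ → Bool) → count (λ k → A k ∨ B k) n ≤ count A n + count B n
count-∨ zero    A B = z≤n
count-∨ (suc n) A B with A n | B n | count-∨ n A B
... | true  | true  | ih = s≤s (≤-trans ih (+-monoʳ-≤ (count A n) (n≤1+n _)))
... | true  | false | ih = s≤s ih
... | false | true  | ih =
  subst (suc (count (λ k → A k ∨ B k) n) ≤_) (sym (+-suc (count A n) (count B n))) (s≤s ih)
... | false | false | ih = ih

cardCS≤twoM : ∀ x y → cardCS x y ≤ twoM x y
cardCS≤twoM x y =
  ≤-trans (count-∨ N (inSxy x y) (λ k → inTSxy x y k ∨ (inDS x k ∨ inDS y k)))
  (≤-trans (+-monoʳ-≤ cS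
             (≤-trans (count-∨ N (inTSxy x y) (λ k → inDS x k ∨ inDS y k))
                      (+-monoʳ-≤ cT (count-∨ N (inDS x) (inDS y)))))
           (≤-reflexive (trans (sym (+-assoc cS cT (cX + cY))) (sym (+-assoc (cS + cT) cX cY)))))
  where
  N cS cT cX cY : ℕ
  N  = cbound x y
  cS = count (inSxy x y) N
  cT = count (inTSxy x y) N
  cX = count (inDS x) N
  cY = count (inDS y) N

k≤1+t : ∀ k → k ≤ suc (t k)
k≤1+t zero          = z≤n
k≤1+t (suc zero)    = s≤s z≤n
k≤1+t (suc (suc k)) = s≤s (s≤s (k≤1+t k))

1+n≤n+2 : ∀ n → suc n ≤ n + 2
1+n≤n+2 n = ≤-trans (n≤1+n (suc n)) (≤-reflexive (+-comm 2 n))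

inS-below : ∀ (f : ℕ → ℕ) B → (∀ i → B ≤ i → f i ≡ i) → Below (inS f) B
inS-below f B fixes k k∈S with k <? B
... | yes k<B = k<B
... | no  k≮B rewrite fixes k (≮⇒≥ k≮B) | ≡ᵇ-refl k with k∈S
...   | ()

inDS-below : ∀ x → Below (inDS x) (suc (bound x))
inDS-below x k k∈DS with k <? suc (bound x)
... | yes k<1+B = k<1+B
... | no  k≮1+B
    rewrite fixed x k (≤-trans (n≤1+n _) (≮⇒≥ k≮1+B))
          | fixed x (t k) (≤-pred (≤-trans (≮⇒≥ k≮1+B) (k≤1+t k)))
          | ≡ᵇ-refl (t k) with k∈DS
...   | ()

inSxy-below : ∀ x y → Below (inSxy x y) (bound x + bound y)
inSxy-below x y = inS-below (prod x y) (bound x + bound y) fixes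
  where
  fixes : ∀ i → bound x + bound y ≤ i → prod x y i ≡ i
  fixes i B≤i rewrite fixed y i (≤-trans (m≤n+m (bound y) (bound x)) B≤i) =
    fixed x i (≤-trans (m≤m+n (bound x) (bound y)) B≤i)

inSxy-bounded : ∀ x y → Below (inSxy x y) (cbound x y)
inSxy-bounded x y k k∈S = <-≤-trans (inSxy-below x y k k∈S) (m≤m+n _ 2)

inTSxy-bounded : ∀ x y → Below (inTSxy x y) (cbound x y)
inTSxy-bounded x y k tk∈S =
  <-≤-trans (s≤s (≤-trans (k≤1+t k) (inSxy-below x y (t k) tk∈S))) (1+n≤n+2 _)

inDSx-bounded : ∀ x y → Below (inDS x) (cbound x y)
inDSx-bounded x y k k∈DS =
  <-≤-trans (inDS-below x k k∈DS) (≤-trans (s≤s (m≤m+n _ _)) (1+n≤n+2 _))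

inDSy-bounded : ∀ x y → Below (inDS y) (cbound x y)
inDSy-bounded x y k k∈DS =
  <-≤-trans (inDS-below y k k∈DS) (≤-trans (s≤s (m≤n+m _ _)) (1+n≤n+2 _))

fun-injective : ∀ a {i j} → fun a i ≡ fun a j → i ≡ j
fun-injective a {i} {j} e = trans (sym (inv-fun a i)) (trans (cong (inv a) e) (inv-fun a j))

inv-InB : ∀ a → InB a → ∀ i → inv a (t i) ≡ t (inv a i)
inv-InB a a∈B i =
  trans (cong (inv a) (sym (trans (a∈B (inv a i)) (cong t (fun-inv a i)))))
        (inv-fun a (t (inv a i)))

inDS-transport : ∀ a b x x' → InB a → InB b →
  (∀ i → fun x' i ≡ fun a (fun x (inv b i))) →
  ∀ k → inDS x' k ≡ inDS x (inv b k)
inDS-transport a b x x' a∈B b∈B x'≡axb⁻¹ k = cong not (begin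
  (fun x' (t k) ≡ᵇ t (fun x' k))
    ≡⟨ cong₂ _≡ᵇ_
         (trans (x'≡axb⁻¹ (t k)) (cong (λ z → fun a (fun x z)) (inv-InB b b∈B k)))
         (trans (cong t (x'≡axb⁻¹ k)) (sym (a∈B _))) ⟩
  (fun a (fun x (t (inv b k))) ≡ᵇ fun a (t (fun x (inv b k))))
    ≡⟨ ≡ᵇ-injective (fun a) (fun-injective a) _ _ ⟩
  (fun x (t (inv b k)) ≡ᵇ t (fun x (inv b k))) ∎)
  where open Relation.Binary.PropositionalEquality.≡-Reasoning

-- For (x', y') = (a x b⁻¹, b y a⁻¹):  x'y' = a (xy) a⁻¹, hence S(x'y') = a(S(xy)).
inSxy-transport : ∀ a b x y x' y' →
  (∀ i → fun x' i ≡ fun a (fun x (inv b i))) →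
  (∀ i → fun y' i ≡ fun b (fun y (inv a i))) →
  ∀ k → inSxy x' y' k ≡ inSxy x y (inv a k)
inSxy-transport a b x y x' y' x'≡axb⁻¹ y'≡bya⁻¹ k = cong not (begin
  (prod x' y' k ≡ᵇ k)
    ≡⟨ cong₂ _≡ᵇ_ x'y'≡axya⁻¹ (sym (fun-inv a k)) ⟩
  (fun a (prod x y (inv a k)) ≡ᵇ fun a (inv a k))
    ≡⟨ ≡ᵇ-injective (fun a) (fun-injective a) _ _ ⟩
  (prod x y (inv a k) ≡ᵇ inv a k) ∎)
  where
  open Relation.Binary.PropositionalEquality.≡-Reasoning
  x'y'≡axya⁻¹ : prod x' y' k ≡ fun a (prod x y (inv a k))
  x'y'≡axya⁻¹ = trans (cong (fun x') (y'≡bya⁻¹ k))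
    (trans (x'≡axb⁻¹ _) (cong (λ z → fun a (fun x z)) (inv-fun b _)))

-- Since a commutes with t, also t(S(x'y')) = a(t(S(xy))).
inTSxy-transport : ∀ a b x y x' y' → InB a →
  (∀ i → fun x' i ≡ fun a (fun x (inv b i))) →
  (∀ i → fun y' i ≡ fun b (fun y (inv a i))) →
  ∀ k → inTSxy x' y' k ≡ inTSxy x y (inv a k)
inTSxy-transport a b x y x' y' a∈B x'≡ y'≡ k =
  trans (inSxy-transport a b x y x' y' x'≡ y'≡ (t k)) (cong (inSxy x y) (inv-InB a a∈B k))

card-transport : ∀ a x y x' y' (P Q : ℕ → Bool) → (∀ k → Q k ≡ P (inv a k)) →
  Below P (cbound x y) → Below Q (cbound x' y') → card x' y' Q ≡ card x y P
card-transport a x y x' y' P Q Q≡Pa⁻¹ =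
  count-bijection (inv a) (fun a) (inv-fun a) (fun-inv a) P Q Q≡Pa⁻¹ (cbound x y) (cbound x' y')

lemma4p1 : (x y x' y' : FinPerm) → InOrbit x y x' y' →
    (cardCS x' y' ≤ twoM x y) × (twoM x' y' ≡ twoM x y)
lemma4p1 x y x' y' (a , b , a∈B , b∈B , x'≡ , y'≡) =
  ≤-trans (cardCS≤twoM x' y') (≤-reflexive twoM-invariant) , twoM-invariant
  where
  twoM-invariant : twoM x' y' ≡ twoM x y
  twoM-invariant = cong₂ _+_ (cong₂ _+_ (cong₂ _+_
    (card-transport a x y x' y' _ _ (inSxy-transport a b x y x' y' x'≡ y'≡)
                    (inSxy-bounded x y) (inSxy-bounded x' y'))
    (card-transport a x y x' y' _ _ (inTSxy-transport a b x y x' y' a∈B x'≡ y'≡)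
                    (inTSxy-bounded x y) (inTSxy-bounded x' y')))
    (card-transport b x y x' y' _ _ (inDS-transport a b x x' a∈B b∈B x'≡)
                    (inDSx-bounded x y) (inDSx-bounded x' y')))
    (card-transport a x y x' y' _ _ (inDS-transport b a y y' b∈B a∈B y'≡)
                    (inDSy-bounded x y) (inDSy-bounded x' y'))
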